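{- Let $n\ge1$, let $G$ be a graph on $[n]$, and let $R,R'$ be regions of $\mathsf{Ish}(G)$. If $\rho(R)=\rho(R')$ then $\widehat\rho(R)=\widehat\rho(R')$. Moreover, if $\rho(R)=\rho(R')$ or $\widehat\rho(R)=\widehat\rho(R')$, then $R$ and $R'$ have the same Ish ceiling diagram.
   Context: $[n]=\{1,\dots,n\}$; a graph $G$ on $[n]$ is a set of pairs $(i<j)$. In $\mathbb R^n$ with coordinates $x_1,\dots,x_n$, $\mathsf{Ish}(G)=\{x_i-x_j=0:1\le i<j\le n\}\cup\{x_1-x_j=i:(i<j)\in G\}$; its regions are the connected components of the complement of the union of these hyperplanes. A hyperplane not through the origin is a ceiling of a region $R$ if it is the affine span of a facet of $\overline R$ and does not separate $R$ from the origin. The Ish ceiling diagram of $R$ is the pair $(\pi,\epsilon)$ where $\pi\in\mathfrak S_n$ (one-line notation) satisfies $x_{\pi_1}>\dots>x_{\pi_n}$ on $R$, and $\epsilon=\epsilon_1\cdots\epsilon_n$ with $\epsilon_j=i$ if $x_1-x_{\pi_j}=i$ is a ceiling of $R$ and $\epsilon_j=0$ otherwise. Boards: $\widehat B_n=\{(i,j)\in\mathbb Z^2:1\le i\le n,\ 1\le j\le n+i-1\}$ and $B_n=\{(i,j):2\le i\le n,\ 1\le j\le n+i-1\}$, with $i$ the column and $j$ the row. $\widehat\rho(R)$ is the set of $n$ rooks on $\widehat B_n$ consisting, for each $1\le i\le n$, of a rook in column $i$ at $(i,\pi^{ -1}(i))$ if $\epsilon_{\pi^{ -1}(i)}=0$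 and at $(i,n+\epsilon_{\pi^{ -1}(i)})$ if $\epsilon_{\pi^{ -1}(i)}>0$. $\rho(R)$ is the restriction of $\widehat\rho(R)$ to $B_n$ (i.e. the rooks in columns $2,\dots,n$).
   Formalization: The arrangement $\mathsf{Ish}(G)$ is taken in ℚ^n rather than ℝ^n, so regions and the facets defining ceilings are represented by points with rational coordinates. -}

module Defs where

open import Data.Nat using (ℕ; zero; suc; _+_; _≤_)
open import Data.Fin using (Fin; toℕ) renaming (zero to fzero; _<_ to _<ᶠ_)
open import Data.Integer using (+_)
open import Data.Rational using (ℚ; 0ℚ; _-_; _/_) renaming (_<_ to _<ℚ_)
open import Data.Product using (Σ; ∃; ∃-syntax; _×_; _,_)
open import Data.Sum using (_⊎_)
open import Relation.Nullary using (¬_)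
open import Relation.Binary.PropositionalEquality using (_≡_)
open import Function.Bundles using (_⇔_)

-- An element a : Fin n stands for the
-- integer toℕ a + 1 ∈ [n] (both as a vertex/coordinate index and as the
-- constant of an Ish hyperplane).  Points of ℝⁿ are replaced by points of ℚⁿ.

Point : ℕ → Set
Point n = Fin n → ℚ

origin : {n : ℕ} → Point n
origin _ = 0ℚ

-- A graph on [n]: a relation; only pairs with i < j are ever used.
Graph : ℕ → Set₁
Graph n = Fin n → Fin n → Set

data Hyp (n : ℕ) : Set where
  braid : Fin n → Fin n → Hyp n
  ish   : Fin n → Fin n → Hyp n

InIsh : {m : ℕ} → Graph (suc m) → Hyp (suc m) → Set
InIsh G (braid i j) = i <ᶠ j
InIsh G (ish i j)   = (i <ᶠ j) × G i j

lhs : {m : ℕ} → Hyp (suc m) → Point (suc m) → ℚ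
lhs (braid i j) x = x i - x j
lhs (ish i j)   x = x fzero - x j

rhs : {m : ℕ} → Hyp (suc m) → ℚ
rhs (braid i j) = 0ℚ
rhs (ish i j)   = + (suc (toℕ i)) / 1

SameSide : {m : ℕ} → Hyp (suc m) → Point (suc m) → Point (suc m) → Set
SameSide H q p = ((lhs H q <ℚ rhs H) × (lhs H p <ℚ rhs H))
               ⊎ ((rhs H <ℚ lhs H q) × (rhs H <ℚ lhs H p))

-- p lies on no hyperplane of Ish(G); such a p determines the region
-- { q generic | ∀ H ∈ Ish(G), SameSide H q p } containing it.
Generic : {m : ℕ} → Graph (suc m) → Point (suc m) → Set
Generic G p = ∀ H → InIsh G H → ¬ (lhs H p ≡ rhs H)

-- H is (the affine span of) a facet of the closure of the region of p:
-- some point of H lies strictly on p's side of every other hyperplane.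
IsFacetHyp : {m : ℕ} → Graph (suc m) → Point (suc m) → Hyp (suc m) → Set
IsFacetHyp G p H =
  ∃[ q ] ((lhs H q ≡ rhs H) × (∀ K → InIsh G K → ¬ (K ≡ H) → SameSide K q p))

Ceiling : {m : ℕ} → Graph (suc m) → Point (suc m) → Hyp (suc m) → Set
Ceiling G p H =
  InIsh G H
  × ¬ (lhs H origin ≡ rhs H)
  × IsFacetHyp G p H
  × SameSide H origin p

-- (π , ε) is the Ish ceiling diagram of the region of p.
-- π j (j : Fin n, standing for position j+1) is the vertex π_{j+1};
-- ε j ∈ ℕ.
IsCeilingDiagram : {m : ℕ} → Graph (suc m) → Point (suc m)
                 → (Fin (suc m) → Fin (suc m)) → (Fin (suc m) → ℕ) → Set
IsCeilingDiagram G p π ε =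
  (∀ a b → a <ᶠ b → p (π b) <ℚ p (π a))
  × (∀ j → ((ε j ≡ 0) × (∀ i → ¬ Ceiling G p (ish i (π j))))
         ⊎ (∃[ i ] ((ε j ≡ suc (toℕ i)) × Ceiling G p (ish i (π j)))))

-- row of the rook attached to position j (1-based rows)
rookRow : {m : ℕ} → (Fin (suc m) → ℕ) → Fin (suc m) → ℕ
rookRow {m} ε j with ε j
... | zero  = suc (toℕ j)
... | suc e = suc m + suc e

-- ρ̂(R) as a set of cells (column , row) of Ẑ-board, 1-based:
-- the rook in column π_j is at row j or n + ε_j.
RooksHat : {m : ℕ} → (Fin (suc m) → Fin (suc m)) → (Fin (suc m) → ℕ)
         → ℕ × ℕ → Set
RooksHat π ε (c , r) = ∃[ j ] ((c ≡ suc (toℕ (π j))) × (r ≡ rookRow ε j))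

Rooks : {m : ℕ} → (Fin (suc m) → Fin (suc m)) → (Fin (suc m) → ℕ)
      → ℕ × ℕ → Set
Rooks π ε (c , r) = (2 ≤ c) × RooksHat π ε (c , r)

_≐_ : (ℕ × ℕ → Set) → (ℕ × ℕ → Set) → Set
A ≐ B = ∀ x → A x ⇔ B x

module Submission where

-- Reading the rooks in columns 2,…,n recovers, for every vertex v ≠ 1, its position
-- if v carries no ceiling and its ceiling label otherwise.  Geometrically, ceiling
-- labels strictly increase from left to right and every ceiling vertex lies to the
-- right of vertex 1.  So two regions with the same rooks have diagrams that agree
-- position by position (strong induction on the position): at a first disagreement
-- both diagrams would carry a ceiling vertex whose copy in the other diagram sits
-- further right, and the labels of these two ceilings would have to cross.

open import Defs
open import Data.Nat using (ℕ; zero; suc; z≤n; s≤s; z<s)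
open import Data.Fin using (Fin; toℕ; _<_; punchOut) renaming (zero to fzero)
open import Data.Product using (_×_; _,_; ∃-syntax; proj₁; proj₂; map; map₂)
open import Data.Sum using (_⊎_; inj₁; inj₂; [_,_]′)
open import Relation.Binary.PropositionalEquality using (_≡_; _≢_; refl; sym; trans; cong; subst; subst₂)

import Data.Nat as ℕ
import Data.Nat.Properties as ℕ
import Data.Fin.Properties as Fin
import Data.Integer as ℤ
import Data.Integer.Properties as ℤ
open import Data.Nat.Coprimality using (Coprime; 1-coprimeTo)
import Data.Nat.Coprimality as Coprime
open import Data.Rational as ℚ using (0ℚ; _-_; -_)
import Data.Rational.Properties as ℚ
open import Algebra.Properties.Group ℚ.+-0-group using (//-rightDividesˡ)
open import Data.Empty using (⊥; ⊥-elim)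
open import Function.Base using (_∘_)
open import Function.Bundles using (mk⇔; Equivalence)
open import Function.Definitions using (Injective; StrictlySurjective)
import Function.Properties.Equivalence as ⇔
open import Relation.Binary.Definitions using (tri<; tri≈; tri>)
open import Relation.Nullary using (¬_; yes; no; contradiction)
open import Data.Fin.Induction using (<-wellFounded)
open import Induction.WellFounded using (module All)
open import Level using (0ℓ)

p-q<0⇒p<q : ∀ {p q} → p - q ℚ.< 0ℚ → p ℚ.< q
p-q<0⇒p<q {p} {q} h = subst₂ ℚ._<_ (//-rightDividesˡ q p) (ℚ.+-identityˡ q) (ℚ.+-monoˡ-< q h)

0<p-q⇒q<p : ∀ {p q} → 0ℚ ℚ.< p - q → q ℚ.< p
0<p-q⇒q<p {p} {q} h = subst₂ ℚ._<_ (ℚ.+-identityˡ q) (//-rightDividesˡ q p) (ℚ.+-monoˡ-< q h)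

p<q⇒p-q<0 : ∀ {p q} → p ℚ.< q → p - q ℚ.< 0ℚ
p<q⇒p-q<0 {p} {q} h = subst (p - q ℚ.<_) (ℚ.+-inverseʳ q) (ℚ.+-monoˡ-< (- q) h)

p<q⇒0<q-p : ∀ {p q} → p ℚ.< q → 0ℚ ℚ.< q - p
p<q⇒0<q-p {p} {q} h = subst (ℚ._< q - p) (ℚ.+-inverseʳ p) (ℚ.+-monoˡ-< (- p) h)

0<[1+n]/1 : ∀ n → 0ℚ ℚ.< ℤ.+ suc n ℚ./ 1
0<[1+n]/1 n = ℚ.positive⁻¹ _ {{ℚ.normalize-pos (suc n) 1}}

m/1<n/1⇒m<n : ∀ {m n} → ℤ.+ m ℚ./ 1 ℚ.< ℤ.+ n ℚ./ 1 → m ℕ.< n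
m/1<n/1⇒m<n {m} {n} h =
  ℤ.drop‿+<+ (subst₂ ℤ._<_ (ℤ.*-identityʳ (ℤ.+ m)) (ℤ.*-identityʳ (ℤ.+ n)) (ℚ.drop-*<*
    (subst₂ ℚ._<_ (ℚ.normalize-coprime (coprime-1 m)) (ℚ.normalize-coprime (coprime-1 n)) h)))
  where
  coprime-1 : ∀ k → Coprime k 1
  coprime-1 k = Coprime.sym (1-coprimeTo k)

injective⇒strictlySurjective : ∀ {n} {f : Fin n → Fin n} →
  Injective _≡_ _≡_ f → StrictlySurjective _≡_ f
injective⇒strictlySurjective {suc n} {f} f-inj i with Fin.any? (λ j → f j Fin.≟ i)
... | yes hit = hit
... | no ¬hit = contradiction (Fin.injective⇒≤ punchOut∘f-injective) ℕ.1+n≰n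
  where
  f≢i : ∀ j → i ≢ f j
  f≢i j i≡fj = ¬hit (j , sym i≡fj)

  punchOut∘f-injective : Injective _≡_ _≡_ (λ j → punchOut (f≢i j))
  punchOut∘f-injective = f-inj ∘ Fin.punchOut-injective (f≢i _) (f≢i _)

module _ {m : ℕ} (H : Hyp (suc m)) (q p : Point (suc m)) where

  sameSide-sym : SameSide H q p → SameSide H p q
  sameSide-sym (inj₁ (q< , p<)) = inj₁ (p< , q<)
  sameSide-sym (inj₂ (<q , <p)) = inj₂ (<p , <q)

  sameSide-below : SameSide H q p → lhs H p ℚ.< rhs H → lhs H q ℚ.< rhs H
  sameSide-below (inj₁ (q< , _)) _  = q<
  sameSide-below (inj₂ (_ , <p)) p< = contradiction <p (ℚ.<-asym p<)

  sameSide-above : SameSide H q p → rhs H ℚ.< lhs H p → rhs H ℚ.< lhs H q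
  sameSide-above (inj₁ (_ , p<)) <p = contradiction p< (ℚ.<-asym <p)
  sameSide-above (inj₂ (<q , _)) _  = <q

sameBraidSides⇒sameOrder : ∀ {m} (q p : Point (suc m)) →
  (∀ {u v} → u < v → SameSide (braid u v) q p) →
  ∀ {u v} → p v ℚ.< p u → q v ℚ.< q u
sameBraidSides⇒sameOrder q p side {u} {v} pv<pu with Fin.<-cmp u v
... | tri< u<v _ _ = 0<p-q⇒q<p (sameSide-above (braid u v) q p (side u<v) (p<q⇒0<q-p pv<pu))
... | tri≈ _ refl _ = contradiction pv<pu (ℚ.<-irrefl refl)
... | tri> _ _ v<u = p-q<0⇒p<q (sameSide-below (braid v u) q p (side v<u) (p<q⇒p-q<0 pv<pu))

record Admissible {m : ℕ} (π : Fin (suc m) → Fin (suc m)) (ε : Fin (suc m) → ℕ) : Set where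
  field
    π-injective         : Injective _≡_ _≡_ π
    ceiling⇒≢1          : ∀ {j e} → ε j ≡ suc e → π j ≢ fzero
    ceilings-increasing : ∀ {a b e f} → a < b → ε a ≡ suc e → ε b ≡ suc f → e ℕ.< f
    1-precedes-ceilings : ∀ {a b e} → π a ≡ fzero → ε b ≡ suc e → a < b

  1⇒no-ceiling : ∀ {j} → π j ≡ fzero → ε j ≡ 0
  1⇒no-ceiling {j} πj≡1 with ε j in εj≡
  ... | zero  = refl
  ... | suc _ = contradiction πj≡1 (ceiling⇒≢1 εj≡)

module CeilingDiagramGeometry {m : ℕ} (G : Graph (suc m)) (p : Point (suc m))
  {π : Fin (suc m) → Fin (suc m)} {ε : Fin (suc m) → ℕ} (D : IsCeilingDiagram G p π ε) where

  decreasing : ∀ {a b} → a < b → p (π b) ℚ.< p (π a)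
  decreasing = proj₁ D _ _

  π-injective : Injective _≡_ _≡_ π
  π-injective {a} {b} πa≡πb with Fin.<-cmp a b
  ... | tri< a<b _ _ = contradiction (decreasing a<b) (ℚ.<-irrefl (cong p (sym πa≡πb)))
  ... | tri≈ _ a≡b _ = a≡b
  ... | tri> _ _ b<a = contradiction (decreasing b<a) (ℚ.<-irrefl (cong p πa≡πb))

  ceiling-at : ∀ {j e} → ε j ≡ suc e → ∃[ i ] e ≡ toℕ i × Ceiling G p (ish i (π j))
  ceiling-at {j} εj≡1+e with proj₂ D j
  ... | inj₁ (εj≡0 , _)       = contradiction (trans (sym εj≡0) εj≡1+e) ℕ.0≢1+n
  ... | inj₂ (i , εj≡1+i , C) = i , ℕ.suc-injective (trans (sym εj≡1+e) εj≡1+i) , C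

  0<ish-target : ∀ {i v} → InIsh G (ish i v) → fzero {m} < v
  0<ish-target (i<v , _) = ℕ.≤-<-trans z≤n i<v

  ceiling⇒≢1 : ∀ {j e} → ε j ≡ suc e → π j ≢ fzero
  ceiling⇒≢1 εj≡1+e with ceiling-at εj≡1+e
  ... | _ , _ , (inG , _) = Fin.<⇒≢ (0<ish-target inG) ∘ sym

  -- A facet point of the ceiling x₁ - x_{π b} = i lies strictly above the braid
  -- hyperplane x₁ = x_{π b}, hence so does the whole region.
  ceiling-after-1 : ∀ {a b i} → π a ≡ fzero → Ceiling G p (ish i (π b)) → ¬ b < a
  ceiling-after-1 {a} {b} {i} πa≡1 (inG , _ , (q , q-on-H , side) , _) b<a =
    ℚ.<-asym p₁<p[πb] (0<p-q⇒q<p p-above)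
    where
    K : Hyp (suc m)
    K = braid fzero (π b)

    p₁<p[πb] : p fzero ℚ.< p (π b)
    p₁<p[πb] = subst (λ x → p x ℚ.< p (π b)) πa≡1 (decreasing b<a)

    q-above : 0ℚ ℚ.< q fzero - q (π b)
    q-above = subst (0ℚ ℚ.<_) (sym q-on-H) (0<[1+n]/1 (toℕ i))

    p-above : 0ℚ ℚ.< p fzero - p (π b)
    p-above = sameSide-above K p q (sameSide-sym K q p (side K (0<ish-target inG) λ ())) q-above

  1-precedes-ceilings : ∀ {a b e} → π a ≡ fzero → ε b ≡ suc e → a < b
  1-precedes-ceilings {a} {b} πa≡1 εb≡1+e with ceiling-at εb≡1+e | Fin.<-cmp a b
  ... | _     | tri< a<b _ _ = a<b
  ... | _     | tri≈ _ refl _ = contradiction πa≡1 (ceiling⇒≢1 εb≡1+e)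
  ... | _ , _ , C | tri> _ _ b<a = contradiction b<a (ceiling-after-1 πa≡1 C)

  -- A facet point q of the ceiling at a keeps x_{π b} < x_{π a} and lies on the
  -- origin's side of the ceiling at b.
  ceiling-constants-increase : ∀ {a b i k} → a < b →
    Ceiling G p (ish i (π a)) → Ceiling G p (ish k (π b)) → toℕ i ℕ.< toℕ k
  ceiling-constants-increase {a} {b} {i} {k} a<b
    (_ , _ , (q , q-on-H , side) , _) (inG , _ , _ , origin-side) =
    ℕ.s<s⁻¹ (m/1<n/1⇒m<n (begin-strict
      ℤ.+ suc (toℕ i) ℚ./ 1  ≡⟨ sym q-on-H ⟩
      q fzero - q (π a)      <⟨ ℚ.+-monoʳ-< (q fzero) (ℚ.neg-antimono-< q[πb]<q[πa]) ⟩
      q fzero - q (π b)      <⟨ q-below ⟩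
      ℤ.+ suc (toℕ k) ℚ./ 1  ∎))
    where
    open ℚ.≤-Reasoning

    K : Hyp (suc m)
    K = ish k (π b)

    ish-injectiveʳ : ∀ {k i v u : Fin (suc m)} → ish k v ≡ ish i u → v ≡ u
    ish-injectiveʳ refl = refl

    K≢H : K ≢ ish i (π a)
    K≢H = Fin.<⇒≢ a<b ∘ sym ∘ π-injective ∘ ish-injectiveʳ

    q[πb]<q[πa] : q (π b) ℚ.< q (π a)
    q[πb]<q[πa] = sameBraidSides⇒sameOrder q p (λ u<v → side (braid _ _) u<v λ ()) (decreasing a<b)

    p-below : p fzero - p (π b) ℚ.< ℤ.+ suc (toℕ k) ℚ./ 1
    p-below = sameSide-below K p origin (sameSide-sym K origin p origin-side) (0<[1+n]/1 (toℕ k))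

    q-below : q fzero - q (π b) ℚ.< ℤ.+ suc (toℕ k) ℚ./ 1
    q-below = sameSide-below K q p (side K inG K≢H) p-below

  ceilings-increasing : ∀ {a b e f} → a < b → ε a ≡ suc e → ε b ≡ suc f → e ℕ.< f
  ceilings-increasing a<b εa≡1+e εb≡1+f with ceiling-at εa≡1+e | ceiling-at εb≡1+f
  ... | _ , refl , Ca | _ , refl , Cb = ceiling-constants-increase a<b Ca Cb

  admissible : Admissible π ε
  admissible = record
    { π-injective         = π-injective
    ; ceiling⇒≢1          = ceiling⇒≢1
    ; ceilings-increasing = ceilings-increasing
    ; 1-precedes-ceilings = 1-precedes-ceilings
    }

position-row<ceiling-row : ∀ {m} (j : Fin (suc m)) e → suc (toℕ j) ℕ.< suc m ℕ.+ suc e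
position-row<ceiling-row {m} j _ = ℕ.≤-<-trans (Fin.toℕ<n j) (ℕ.m<m+n (suc m) z<s)

rookRow-cancel : ∀ {m} (ε ε' : Fin (suc m) → ℕ) {j j'} →
  rookRow ε j ≡ rookRow ε' j' → ε j ≡ ε' j' × (ε j ≡ 0 → j ≡ j')
rookRow-cancel {m} ε ε' {j} {j'} rows≡ with ε j | ε' j'
... | zero  | zero   = refl , λ _ → Fin.toℕ-injective (ℕ.suc-injective rows≡)
... | zero  | suc e' = contradiction rows≡ (ℕ.<⇒≢ (position-row<ceiling-row j e'))
... | suc e | zero   = contradiction (sym rows≡) (ℕ.<⇒≢ (position-row<ceiling-row j' e))
... | suc e | suc e' = ℕ.+-cancelˡ-≡ (suc m) _ _ rows≡ , λ ()

rookRow-cong : ∀ {m} (ε ε' : Fin (suc m) → ℕ) {j} → ε j ≡ ε' j → rookRow ε j ≡ rookRow ε' j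
rookRow-cong {m} ε ε' {j} εj≡ε'j with ε j | ε' j
... | zero  | zero  = refl
... | suc _ | suc _ = cong (suc m ℕ.+_) εj≡ε'j

rook-match : ∀ {m} {π π' : Fin (suc m) → Fin (suc m)} {ε ε' : Fin (suc m) → ℕ} →
  Rooks π ε ≐ Rooks π' ε' → ∀ {j} → π j ≢ fzero →
  ∃[ j' ] π j ≡ π' j' × ε j ≡ ε' j' × (ε j ≡ 0 → j ≡ j')
rook-match {π = π} {ε = ε} {ε'} R {j} πj≢1
  with Equivalence.to (R (suc (toℕ (π j)) , rookRow ε j))
         (s≤s (ℕ.n≢0⇒n>0 (πj≢1 ∘ Fin.toℕ-injective)) , j , refl , refl)
... | _ , j' , cols≡ , rows≡ =
  j' , Fin.toℕ-injective (ℕ.suc-injective cols≡) , rookRow-cancel ε ε' rows≡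

≢0⇒≡suc : ∀ {n} → n ≢ 0 → ∃[ e ] n ≡ suc e
≢0⇒≡suc {zero}  0≢0 = contradiction refl 0≢0
≢0⇒≡suc {suc e} _   = e , refl

hits-not-before : ∀ {n} {A : Set} {f g : Fin n → A} {j k} → Injective _≡_ _≡_ f →
  (∀ {i} → i < j → f i ≡ g i) → g k ≡ f j → k ≡ j ⊎ j < k
hits-not-before {j = j} {k} f-inj agree gk≡fj with Fin.<-cmp k j
... | tri< k<j _ _ = contradiction (f-inj (trans (agree k<j) gk≡fj)) (Fin.<⇒≢ k<j)
... | tri≈ _ k≡j _ = inj₁ k≡j
... | tri> _ _ j<k = inj₂ j<k

module Agreement {m : ℕ} {π π' : Fin (suc m) → Fin (suc m)} {ε ε' : Fin (suc m) → ℕ}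
  (A : Admissible π ε) (A' : Admissible π' ε') (R : Rooks π ε ≐ Rooks π' ε')
  {j : Fin (suc m)} (agree-before : ∀ {k} → k < j → π k ≡ π' k) where

  private
    module A  = Admissible A
    module A' = Admissible A'

  1-not-at-ceiling : ∀ {e} → ε j ≡ suc e → π' j ≢ fzero
  1-not-at-ceiling εj≡1+e π'j≡1 with injective⇒strictlySurjective A.π-injective fzero
  ... | a , πa≡1 = Fin.<⇒≢ a<j (A'.π-injective π'a≡π'j)
    where
    a<j : a < j
    a<j = A.1-precedes-ceilings πa≡1 εj≡1+e

    π'a≡π'j : π' a ≡ π' j
    π'a≡π'j = trans (sym (agree-before a<j)) (trans πa≡1 (sym π'j≡1))

  -- π' j ≢ 1 as vertex 1 precedes the ceiling at j in π; so π' j sits at some k > j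
  -- in π, and the ceilings at j, k in π and at j, j' in π' would have crossing labels.
  no-later-match : ∀ {j' e} → j < j' → π j ≡ π' j' → ε j ≡ suc e → ε' j' ≡ suc e → ⊥
  no-later-match j<j' πj≡π'j' εj≡1+e ε'j'≡1+e
    with rook-match {π = π'} {π} {ε'} {ε} (⇔.sym ∘ R) (1-not-at-ceiling εj≡1+e)
  ... | k , π'j≡πk , ε'j≡εk , ε'j≡0⇒j≡k
    with hits-not-before A'.π-injective (sym ∘ agree-before) (sym π'j≡πk)
  ... | inj₁ refl = Fin.<⇒≢ j<j' (A'.π-injective (trans π'j≡πk πj≡π'j'))
  ... | inj₂ j<k with ≢0⇒≡suc (Fin.<⇒≢ j<k ∘ ε'j≡0⇒j≡k)
  ...   | _ , ε'j≡1+e' =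
    ℕ.<-asym (A.ceilings-increasing j<k εj≡1+e (trans (sym ε'j≡εk) ε'j≡1+e'))
             (A'.ceilings-increasing j<j' ε'j≡1+e' ε'j'≡1+e)

  agree-at-nonfirst : π j ≢ fzero → π j ≡ π' j × ε j ≡ ε' j
  agree-at-nonfirst πj≢1 with rook-match {π = π} {π'} {ε} {ε'} R πj≢1
  ... | j' , πj≡π'j' , εj≡ε'j' , εj≡0⇒j≡j'
    with hits-not-before A.π-injective agree-before (sym πj≡π'j')
  ... | inj₁ refl = πj≡π'j' , εj≡ε'j'
  ... | inj₂ j<j' with ≢0⇒≡suc (Fin.<⇒≢ j<j' ∘ εj≡0⇒j≡j')
  ...   | _ , εj≡1+e =
    ⊥-elim (no-later-match j<j' πj≡π'j' εj≡1+e (trans (sym εj≡ε'j') εj≡1+e))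

agree-at : ∀ {m} {π π' : Fin (suc m) → Fin (suc m)} {ε ε' : Fin (suc m) → ℕ} →
  Admissible π ε → Admissible π' ε' → Rooks π ε ≐ Rooks π' ε' →
  ∀ j → (∀ {k} → k < j → π k ≡ π' k) → π j ≡ π' j × ε j ≡ ε' j
agree-at {π = π} {π'} A A' R j agree-before with π j Fin.≟ fzero | π' j Fin.≟ fzero
... | no πj≢1 | _ = Agreement.agree-at-nonfirst A A' R agree-before πj≢1
... | yes _   | no π'j≢1 =
  map sym sym (Agreement.agree-at-nonfirst A' A (⇔.sym ∘ R) (sym ∘ agree-before) π'j≢1)
... | yes πj≡1 | yes π'j≡1 =
  trans πj≡1 (sym π'j≡1) ,
  trans (Admissible.1⇒no-ceiling A πj≡1) (sym (Admissible.1⇒no-ceiling A' π'j≡1))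

rooks-determine-diagram : ∀ {m} {π π' : Fin (suc m) → Fin (suc m)} {ε ε' : Fin (suc m) → ℕ} →
  Admissible π ε → Admissible π' ε' → Rooks π ε ≐ Rooks π' ε' → ∀ j → π j ≡ π' j × ε j ≡ ε' j
rooks-determine-diagram {π = π} {π'} {ε} {ε'} A A' R =
  All.wfRec <-wellFounded 0ℓ (λ j → π j ≡ π' j × ε j ≡ ε' j)
    λ j ih → agree-at A A' R j (proj₁ ∘ ih)

RooksHat-cong : ∀ {m} {π π' : Fin (suc m) → Fin (suc m)} {ε ε' : Fin (suc m) → ℕ} →
  (∀ j → π j ≡ π' j × ε j ≡ ε' j) → RooksHat π ε ≐ RooksHat π' ε'
RooksHat-cong same x = mk⇔ (transport same) (transport (map sym sym ∘ same))
  where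
  transport : ∀ {m} {π π' : Fin (suc m) → Fin (suc m)} {ε ε' : Fin (suc m) → ℕ} {x} →
    (∀ j → π j ≡ π' j × ε j ≡ ε' j) → RooksHat π ε x → RooksHat π' ε' x
  transport {ε = ε} {ε'} same (j , col≡ , row≡) =
    j , trans col≡ (cong (suc ∘ toℕ) (proj₁ (same j)))
      , trans row≡ (rookRow-cong ε ε' (proj₂ (same j)))

RooksHat⇒Rooks : ∀ {m} {π π' : Fin (suc m) → Fin (suc m)} {ε ε' : Fin (suc m) → ℕ} →
  RooksHat π ε ≐ RooksHat π' ε' → Rooks π ε ≐ Rooks π' ε'
RooksHat⇒Rooks R̂ x@(_ , _) =
  mk⇔ (map₂ (Equivalence.to (R̂ x))) (map₂ (Equivalence.from (R̂ x)))

lemma4p1 : (m : ℕ) (G : Graph (suc m)) (p p' : Point (suc m))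
    → Generic G p → Generic G p'
    → (π π' : Fin (suc m) → Fin (suc m)) (ε ε' : Fin (suc m) → ℕ)
    → IsCeilingDiagram G p π ε → IsCeilingDiagram G p' π' ε'
    → ((Rooks π ε ≐ Rooks π' ε') → (RooksHat π ε ≐ RooksHat π' ε'))
      × (((Rooks π ε ≐ Rooks π' ε') ⊎ (RooksHat π ε ≐ RooksHat π' ε'))
         → ∀ j → (π j ≡ π' j) × (ε j ≡ ε' j))
lemma4p1 m G p p' _ _ π π' ε ε' D D' =
  RooksHat-cong ∘ determined ,
  [ determined , determined ∘ RooksHat⇒Rooks {π = π} {π'} {ε} {ε'} ]′
  where
  determined : Rooks π ε ≐ Rooks π' ε' → ∀ j → π j ≡ π' j × ε j ≡ ε' j
  determined = rooks-determine-diagram (CeilingDiagramGeometry.admissible G p D)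
                                       (CeilingDiagramGeometry.admissible G p' D')
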